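{- Let $X$ be a class I graph with no isolated vertices and let $\mathrm{TR}(X)$ be a generalized truncation of $X$. If $\Delta(X)=\Delta(\mathrm{TR}(X))$, then $\mathrm{TR}(X)$ is class I.
   Context: Generalized truncation of $X$: for each edge $e=[u,v]$ of $X$ take a new edge (these form a matching $M_F$) whose two ends are labelled $u$ and $v$. For each vertex $v$ of $X$, the cluster $\mathrm{cl}(v)$ is the set of ends labelled $v$; insert an arbitrary simple graph $\mathrm{con}(v)$ on $\mathrm{cl}(v)$. The graph $M_F\cup\bigcup_v\mathrm{con}(v)$ is a generalized truncation $\mathrm{TR}(X)$. $\Delta(\cdot)$ denotes maximum valency. A graph is class I if its chromatic index equals its maximum valency. -}

module Defs where

open import Data.Nat using (ℕ; _⊔_; _≤_)
open import Data.Fin using (Fin; _↑ˡ_; _↑ʳ_; splitAt)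
open import Data.Fin.Properties using (_≟_)
open import Data.Product using (_×_; _,_; proj₁; proj₂; ∃)
open import Data.Sum using (_⊎_; [_,_]′)
open import Data.List using (List; length; filter; map; foldr; allFin)
open import Relation.Nullary using (¬_; Dec)
open import Relation.Nullary.Decidable using (_⊎-dec_)
open import Relation.Binary.PropositionalEquality using (_≡_; _≢_)

record Graph (n : ℕ) : Set where
  constructor mkGraph
  field
    m    : ℕ
    ends : Fin m → Fin n × Fin n
open Graph public

SameEnds : ∀ {n} → Fin n × Fin n → Fin n × Fin n → Set
SameEnds (a , b) (c , d) = (a ≡ c × b ≡ d) ⊎ (a ≡ d × b ≡ c)

IsSimple : ∀ {n} → Graph n → Set
IsSimple G =
  (∀ e → proj₁ (ends G e) ≢ proj₂ (ends G e)) ×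
  (∀ e e' → SameEnds (ends G e) (ends G e') → e ≡ e')

Incident : ∀ {n} (G : Graph n) → Fin (m G) → Fin n → Set
Incident G e v = (v ≡ proj₁ (ends G e)) ⊎ (v ≡ proj₂ (ends G e))

incident? : ∀ {n} (G : Graph n) e v → Dec (Incident G e v)
incident? G e v = (v ≟ proj₁ (ends G e)) ⊎-dec (v ≟ proj₂ (ends G e))

deg : ∀ {n} → Graph n → Fin n → ℕ
deg G v = length (filter (λ e → incident? G e v) (allFin (m G)))

Δ : ∀ {n} → Graph n → ℕ
Δ {n} G = foldr _⊔_ 0 (map (deg G) (allFin n))

NoIsolatedVertices : ∀ {n} → Graph n → Set
NoIsolatedVertices {n} G = (v : Fin n) → ∃ λ e → Incident G e v

ProperEdgeColouring : ∀ {n} (G : Graph n) (k : ℕ) → (Fin (m G) → Fin k) → Set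
ProperEdgeColouring G k c =
  ∀ e e' → e ≢ e' → (∃ λ v → Incident G e v × Incident G e' v) → c e ≢ c e'

EdgeColourable : ∀ {n} → Graph n → ℕ → Set
EdgeColourable G k = ∃ λ (c : Fin (m G) → Fin k) → ProperEdgeColouring G k c

ChromaticIndexIs : ∀ {n} → Graph n → ℕ → Set
ChromaticIndexIs G k = EdgeColourable G k × (∀ j → EdgeColourable G j → k ≤ j)

ClassI : ∀ {n} → Graph n → Set
ClassI G = ChromaticIndexIs G (Δ G)

-- The ends of the new edges (darts) are Fin (m + m): the dart  e ↑ˡ m  is
-- the end of the new edge for e labelled by the first endpoint of e, and
-- m ↑ʳ e  the end labelled by the second endpoint.

label : ∀ {n} (X : Graph n) → Fin (m X Data.Nat.+ m X) → Fin n
label X d = [ (λ e → proj₁ (ends X e)) , (λ e → proj₂ (ends X e)) ]′ (splitAt (m X) d)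

-- con is a graph on the darts; the union of the con(v) is a simple graph on
-- all darts each of whose edges lies inside one cluster cl(v).
IsClusterGraph : ∀ {n} (X : Graph n) → Graph (m X Data.Nat.+ m X) → Set
IsClusterGraph X con =
  IsSimple con × (∀ f → label X (proj₁ (ends con f)) ≡ label X (proj₂ (ends con f)))

-- TR(X) = M_F ∪ ⋃ con(v): edges Fin (m X + m con), the first m X being the
-- matching M_F.
TR : ∀ {n} (X : Graph n) → Graph (m X Data.Nat.+ m X) → Graph (m X Data.Nat.+ m X)
TR X con = mkGraph (m X Data.Nat.+ m con)
  (λ i → [ (λ e → (e ↑ˡ m X) , (m X ↑ʳ e)) , ends con ]′ (splitAt (m X) i))

{-# OPTIONS --safe #-}
module Submission where

-- Properly colour X with k = Δ(X) colours and give each end of a matching edge the colour of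
-- its edge of X; the ends in one cluster cl(v) then have distinct colours, as the edges at v do.
-- Colour the matching edge of e by c(e) + c(e) and an edge [d, d'] of con(v) by c(d) + c(d'),
-- addition modulo k. At an end d the edges of TR(X) get c(d) + c(d) and c(d) + c(d') for the
-- neighbours d' of d in con(v); these are pairwise distinct because addition is cancellative
-- and the c(d') differ from c(d) and from each other. So TR(X) is Δ(X)-edge-colourable, and no
-- graph is edge-colourable with fewer colours than its maximum valency.

open import Defs
open import Data.Nat using (ℕ; zero; suc; s≤s; _+_; _∸_; _≤_; _<_; z≤n; NonZero)
open import Data.Nat.Properties using (+-comm; +-assoc; m∸n+n≡m; ⊔-lub; ≮⇒≥)
open import Data.Nat.DivMod using (_%_; _mod_; %-distribˡ-+; [m+n]%n≡m%n; m<n⇒m%n≡m)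
open import Data.Fin as Fin using (Fin; zero; suc; toℕ; _↑ˡ_; _↑ʳ_; splitAt)
open import Data.Fin.Properties
  using (toℕ-injective; toℕ-fromℕ<; toℕ<n; toℕ≤n; pigeonhole; splitAt-↑ˡ; splitAt-↑ʳ; _≟_)
open import Data.Product using (_×_; _,_; proj₁; proj₂; ∃)
open import Data.Sum using (_⊎_; inj₁; inj₂; [_,_]′)
open import Data.List using (List; filter; allFin; lookup)
open import Data.List.Properties using (foldr-preservesᵇ)
import Data.List.Relation.Unary.All as All
open import Data.List.Relation.Unary.All.Properties using (map⁺; tabulate⁺)
open import Data.List.Relation.Unary.AllPairs using (AllPairs; _∷_)
open import Data.List.Relation.Unary.Unique.Propositional using (Unique)
open import Data.List.Relation.Unary.Unique.Propositional.Properties using (allFin⁺; filter⁺)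
open import Data.List.Membership.Propositional.Properties using (∈-lookup; ∈-filter⁻)
open import Data.Empty using (⊥-elim)
open import Function using (id; _∘_)
open import Relation.Nullary using (yes; no)
open import Relation.Binary.PropositionalEquality
open ≡-Reasoning

+-%-cancelˡ : ∀ {k a b b'} .{{_ : NonZero k}} → a ≤ k → b < k → b' < k →
  (a + b) % k ≡ (a + b') % k → b ≡ b'
+-%-cancelˡ {k} {a} {b} {b'} a≤k b<k b'<k eq = begin
  b                                       ≡⟨ negate-add b<k ⟨
  ((k ∸ a) + (a + b)) % k                 ≡⟨ %-distribˡ-+ (k ∸ a) (a + b) k ⟩
  ((k ∸ a) % k + (a + b) % k) % k         ≡⟨ cong (λ x → ((k ∸ a) % k + x) % k) eq ⟩
  ((k ∸ a) % k + (a + b') % k) % k        ≡⟨ %-distribˡ-+ (k ∸ a) (a + b') k ⟨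
  ((k ∸ a) + (a + b')) % k                ≡⟨ negate-add b'<k ⟩
  b'                                      ∎
  where
  negate-add : ∀ {x} → x < k → ((k ∸ a) + (a + x)) % k ≡ x
  negate-add {x} x<k = begin
    ((k ∸ a) + (a + x)) % k   ≡⟨ cong (_% k) (+-assoc (k ∸ a) a x) ⟨
    ((k ∸ a) + a + x) % k     ≡⟨ cong (λ y → (y + x) % k) (m∸n+n≡m a≤k) ⟩
    (k + x) % k               ≡⟨ cong (_% k) (+-comm k x) ⟩
    (x + k) % k               ≡⟨ [m+n]%n≡m%n x k ⟩
    x % k                     ≡⟨ m<n⇒m%n≡m x<k ⟩
    x                         ∎

_⊕_ : ∀ {k} → Fin k → Fin k → Fin k
_⊕_ {suc k} a b = (toℕ a + toℕ b) mod suc k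

⊕-comm : ∀ {k} (a b : Fin k) → a ⊕ b ≡ b ⊕ a
⊕-comm {suc k} a b = cong (_mod suc k) (+-comm (toℕ a) (toℕ b))

⊕-cancelˡ : ∀ {k} (a : Fin k) {b b'} → a ⊕ b ≡ a ⊕ b' → b ≡ b'
⊕-cancelˡ {suc k} a {b} {b'} eq = toℕ-injective
  (+-%-cancelˡ (toℕ≤n a) (toℕ<n b) (toℕ<n b')
    (trans (sym (toℕ-fromℕ< _)) (trans (cong toℕ eq) (toℕ-fromℕ< _))))

allPairs-lookup : ∀ {A : Set} {R : A → A → Set} {xs : List A} → AllPairs R xs →
  ∀ {i j} → i Fin.< j → R (lookup xs i) (lookup xs j)
allPairs-lookup (Rx ∷ _)   {zero}  {suc j} _         = All.lookup Rx (∈-lookup j)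
allPairs-lookup (_ ∷ Rxs) {suc i} {suc j} (s≤s i<j) = allPairs-lookup Rxs i<j

incidentEdges : ∀ {n} (G : Graph n) → Fin n → List (Fin (m G))
incidentEdges G v = filter (λ e → incident? G e v) (allFin (m G))

deg≤colours : ∀ {n} (G : Graph n) {j c} → ProperEdgeColouring G j c → ∀ v → deg G v ≤ j
deg≤colours G {c = c} proper v = ≮⇒≥ λ j<deg →
  let (a , b , a<b , sameColour) = pigeonhole j<deg (λ i → c (lookup (incidentEdges G v) i))
  in proper _ _ (allPairs-lookup distinct a<b) (v , incident a , incident b) sameColour
  where
  distinct : Unique (incidentEdges G v)
  distinct = filter⁺ (λ e → incident? G e v) (allFin⁺ (m G))
  incident : ∀ i → Incident G (lookup (incidentEdges G v) i) v
  incident i = proj₂ (∈-filter⁻ (λ e → incident? G e v) {xs = allFin (m G)} (∈-lookup i))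

Δ≤colours : ∀ {n} (G : Graph n) {j c} → ProperEdgeColouring G j c → Δ G ≤ j
Δ≤colours G {j} proper = foldr-preservesᵇ {P = _≤ j} ⊔-lub z≤n (map⁺ (tabulate⁺ (deg≤colours G proper)))

Δ-colourable⇒classI : ∀ {n} (G : Graph n) → EdgeColourable G (Δ G) → ClassI G
Δ-colourable⇒classI G colourable = colourable , λ j (_ , proper) → Δ≤colours G proper

data SplitView (p q : ℕ) : Fin (p + q) → Set where
  left  : ∀ i → SplitView p q (i ↑ˡ q)
  right : ∀ j → SplitView p q (p ↑ʳ j)

splitView : ∀ p {q} (i : Fin (p + q)) → SplitView p q i
splitView zero          i       = right i
splitView (suc p)       zero    = left zero
splitView (suc p) {q}   (suc i) with splitView p {q} i
... | left i′ = left (suc i′)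
... | right j = right j

module _ {A : Set} {p q : ℕ} (f : Fin p → A) (g : Fin q → A) where

  [,]-splitAt-↑ˡ : ∀ i → [ f , g ]′ (splitAt p (i ↑ˡ q)) ≡ f i
  [,]-splitAt-↑ˡ i = cong [ f , g ]′ (splitAt-↑ˡ p i q)

  [,]-splitAt-↑ʳ : ∀ j → [ f , g ]′ (splitAt p (p ↑ʳ j)) ≡ g j
  [,]-splitAt-↑ʳ j = cong [ f , g ]′ (splitAt-↑ʳ p q j)

Loopless : ∀ {n} → Graph n → Set
Loopless G = ∀ e → proj₁ (ends G e) ≢ proj₂ (ends G e)

incident-ends : ∀ {n} (G : Graph n) {i p v} → ends G i ≡ p → Incident G i v →
  (v ≡ proj₁ p) ⊎ (v ≡ proj₂ p)
incident-ends G {v = v} eq = subst (λ p → (v ≡ proj₁ p) ⊎ (v ≡ proj₂ p)) eq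

otherEnd : ∀ {n} (G : Graph n) {f v} → Incident G f v → ∃ λ w → SameEnds (ends G f) (v , w)
otherEnd G {f} (inj₁ refl) = proj₂ (ends G f) , inj₁ (refl , refl)
otherEnd G {f} (inj₂ refl) = proj₁ (ends G f) , inj₂ (refl , refl)

SameEnds-sym : ∀ {n} {p q : Fin n × Fin n} → SameEnds p q → SameEnds q p
SameEnds-sym (inj₁ (refl , refl)) = inj₁ (refl , refl)
SameEnds-sym (inj₂ (refl , refl)) = inj₂ (refl , refl)

SameEnds-trans : ∀ {n} {p q r : Fin n × Fin n} → SameEnds p q → SameEnds q r → SameEnds p r
SameEnds-trans (inj₁ (refl , refl)) qr                   = qr
SameEnds-trans (inj₂ (refl , refl)) (inj₁ (refl , refl)) = inj₂ (refl , refl)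
SameEnds-trans (inj₂ (refl , refl)) (inj₂ (refl , refl)) = inj₁ (refl , refl)

loopless-SameEnds : ∀ {n} (G : Graph n) → Loopless G → ∀ {f v w} → SameEnds (ends G f) (v , w) → v ≢ w
loopless-SameEnds G loopless {f} (inj₁ (refl , refl)) = loopless f
loopless-SameEnds G loopless {f} (inj₂ (refl , refl)) = loopless f ∘ sym

dartEdge : ∀ {n} (X : Graph n) → Fin (m X + m X) → Fin (m X)
dartEdge X d = [ id , id ]′ (splitAt (m X) d)

module _ {n} (X : Graph n) where

  private
    M = m X

  dartEdge-↑ˡ : ∀ e → dartEdge X (e ↑ˡ M) ≡ e
  dartEdge-↑ˡ = [,]-splitAt-↑ˡ id id

  dartEdge-↑ʳ : ∀ e → dartEdge X (M ↑ʳ e) ≡ e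
  dartEdge-↑ʳ = [,]-splitAt-↑ʳ id id

  label-↑ˡ : ∀ e → label X (e ↑ˡ M) ≡ proj₁ (ends X e)
  label-↑ˡ = [,]-splitAt-↑ˡ (proj₁ ∘ ends X) (proj₂ ∘ ends X)

  label-↑ʳ : ∀ e → label X (M ↑ʳ e) ≡ proj₂ (ends X e)
  label-↑ʳ = [,]-splitAt-↑ʳ (proj₁ ∘ ends X) (proj₂ ∘ ends X)

  dartEdge-incident : ∀ d → Incident X (dartEdge X d) (label X d)
  dartEdge-incident d with splitView M d
  ... | left e  = subst₂ (Incident X) (sym (dartEdge-↑ˡ e)) (sym (label-↑ˡ e)) (inj₁ refl)
  ... | right e = subst₂ (Incident X) (sym (dartEdge-↑ʳ e)) (sym (label-↑ʳ e)) (inj₂ refl)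

  dart-labels-distinct : Loopless X → ∀ {e e'} → e ≡ e' → label X (e ↑ˡ M) ≢ label X (M ↑ʳ e')
  dart-labels-distinct loopless {e} refl sameLabel =
    loopless e (trans (sym (label-↑ˡ e)) (trans sameLabel (label-↑ʳ e)))

  dart-unique : Loopless X → ∀ {d d'} → dartEdge X d ≡ dartEdge X d' → label X d ≡ label X d' → d ≡ d'
  dart-unique loopless {d} {d'} sameEdge sameLabel with splitView M d | splitView M d'
  ... | left e  | left e'  = cong (_↑ˡ M) (trans (sym (dartEdge-↑ˡ e)) (trans sameEdge (dartEdge-↑ˡ e')))
  ... | right e | right e' = cong (M ↑ʳ_) (trans (sym (dartEdge-↑ʳ e)) (trans sameEdge (dartEdge-↑ʳ e')))
  ... | left e  | right e' = ⊥-elim (dart-labels-distinct loopless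
          (trans (sym (dartEdge-↑ˡ e)) (trans sameEdge (dartEdge-↑ʳ e'))) sameLabel)
  ... | right e | left e'  = ⊥-elim (dart-labels-distinct loopless
          (trans (sym (dartEdge-↑ˡ e')) (trans (sym sameEdge) (dartEdge-↑ʳ e))) (sym sameLabel))

  dart-injective : Loopless X → ∀ {k c} → ProperEdgeColouring X k c → ∀ {d d'} →
    label X d ≡ label X d' → c (dartEdge X d) ≡ c (dartEdge X d') → d ≡ d'
  dart-injective loopless proper {d} {d'} sameLabel sameColour with dartEdge X d ≟ dartEdge X d'
  ... | yes sameEdge = dart-unique loopless sameEdge sameLabel
  ... | no distinct  = ⊥-elim (proper _ _ distinct
    (label X d , dartEdge-incident d , subst (Incident X _) (sym sameLabel) (dartEdge-incident d'))
    sameColour)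

module _ {n} (X : Graph n) (con : Graph (m X + m X)) where

  private
    M = m X
    T = TR X con

  TR-matching-incident : ∀ {e v} → Incident T (e ↑ˡ m con) v → dartEdge X v ≡ e
  TR-matching-incident {e} inc with incident-ends T ([,]-splitAt-↑ˡ _ (ends con) e) inc
  ... | inj₁ refl = dartEdge-↑ˡ X e
  ... | inj₂ refl = dartEdge-↑ʳ X e

  TR-cluster-incident : ∀ {f v} → Incident T (M ↑ʳ f) v → Incident con f v
  TR-cluster-incident {f} = incident-ends T ([,]-splitAt-↑ʳ (λ e → e ↑ˡ M , M ↑ʳ e) (ends con) f)

  module _ (loopless : Loopless X) (cluster : IsClusterGraph X con)
           {k} {c : Fin M → Fin k} (proper : ProperEdgeColouring X k c) where

    dartColour : Fin (M + M) → Fin k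
    dartColour d = c (dartEdge X d)

    pairColour : Fin (M + M) × Fin (M + M) → Fin k
    pairColour (a , b) = dartColour a ⊕ dartColour b

    pairColour-SameEnds : ∀ {p q} → SameEnds p q → pairColour p ≡ pairColour q
    pairColour-SameEnds (inj₁ (refl , refl)) = refl
    pairColour-SameEnds (inj₂ (refl , refl)) = ⊕-comm _ _

    label-SameEnds : ∀ {f v w} → SameEnds (ends con f) (v , w) → label X v ≡ label X w
    label-SameEnds {f} (inj₁ (refl , refl)) = proj₂ cluster f
    label-SameEnds {f} (inj₂ (refl , refl)) = sym (proj₂ cluster f)

    matching≢cluster : ∀ {e f v} → dartEdge X v ≡ e → Incident con f v →
      c e ⊕ c e ≢ pairColour (ends con f)
    matching≢cluster refl inc sameColour with otherEnd con inc
    ... | w , vw = loopless-SameEnds con (proj₁ (proj₁ cluster)) vw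
      (dart-injective X loopless proper (label-SameEnds vw)
        (⊕-cancelˡ _ (trans sameColour (pairColour-SameEnds vw))))

    cluster-colour-injective : ∀ {f f' v} → Incident con f v → Incident con f' v →
      pairColour (ends con f) ≡ pairColour (ends con f') → f ≡ f'
    cluster-colour-injective {f} {f'} {v} inc inc' sameColour with otherEnd con inc | otherEnd con inc'
    ... | w , vw | w' , vw' with dart-injective X loopless proper
           (trans (sym (label-SameEnds vw)) (label-SameEnds vw'))
           (⊕-cancelˡ (dartColour v) (trans (sym (pairColour-SameEnds vw)) (trans sameColour (pairColour-SameEnds vw'))))
    ... | refl = proj₂ (proj₁ cluster) f f' (SameEnds-trans vw (SameEnds-sym vw'))

    TR-colour : Fin (m T) → Fin k
    TR-colour i = [ (λ e → c e ⊕ c e) , (λ f → pairColour (ends con f)) ]′ (splitAt M i)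

    TR-colour-matching : ∀ e → TR-colour (e ↑ˡ m con) ≡ c e ⊕ c e
    TR-colour-matching = [,]-splitAt-↑ˡ _ (λ f → pairColour (ends con f))

    TR-colour-cluster : ∀ f → TR-colour (M ↑ʳ f) ≡ pairColour (ends con f)
    TR-colour-cluster = [,]-splitAt-↑ʳ (λ e → c e ⊕ c e) _

    TR-colour-proper : ProperEdgeColouring T k TR-colour
    TR-colour-proper i i' i≢i' (v , inc , inc') with splitView M i | splitView M i'
    ... | left e  | left e'  = ⊥-elim (i≢i' (cong (_↑ˡ m con)
            (trans (sym (TR-matching-incident inc)) (TR-matching-incident inc'))))
    ... | left e  | right f  = λ sameColour → matching≢cluster (TR-matching-incident inc) (TR-cluster-incident inc')
            (trans (sym (TR-colour-matching e)) (trans sameColour (TR-colour-cluster f)))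
    ... | right f | left e   = λ sameColour → matching≢cluster (TR-matching-incident inc') (TR-cluster-incident inc)
            (trans (sym (TR-colour-matching e)) (trans (sym sameColour) (TR-colour-cluster f)))
    ... | right f | right f' = λ sameColour → i≢i' (cong (M ↑ʳ_)
            (cluster-colour-injective (TR-cluster-incident inc) (TR-cluster-incident inc')
              (trans (sym (TR-colour-cluster f)) (trans sameColour (TR-colour-cluster f')))))

TR-edgeColourable : ∀ {n} (X : Graph n) → Loopless X → (con : Graph (m X + m X)) → IsClusterGraph X con →
  ∀ {k} → EdgeColourable X k → EdgeColourable (TR X con) k
TR-edgeColourable X loopless con cluster (c , proper) =
  TR-colour X con loopless cluster proper , TR-colour-proper X con loopless cluster proper

corollary4p2 : ∀ {n} (X : Graph n) → IsSimple X → ClassI X → NoIsolatedVertices X →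
    (con : Graph (m X Data.Nat.+ m X)) → IsClusterGraph X con →
    Δ X ≡ Δ (TR X con) → ClassI (TR X con)
-- No isolated-vertex hypothesis is needed: an isolated vertex of X has an empty cluster.
corollary4p2 X (loopless , _) (colourable , _) _ con cluster Δ-equal =
  Δ-colourable⇒classI (TR X con)
    (subst (EdgeColourable (TR X con)) Δ-equal (TR-edgeColourable X loopless con cluster colourable))
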